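{- Let $k,t,p,n,s$ be positive integers with $k\ge tp$ and $n$ divisible by $t$. Then there is a depth-$1$ $k$-network on arrays of length $np$ such that, whenever the input $0/1$-array is the concatenation of $p$ consecutive blocks of length $n$ each of which is $s$-sorted, the output array (of length $np$) is $(sp+2\frac{np}{t})$-sorted. If additionally $s$ is divisible by $n/t$, then the output is $(sp+\frac{np}{t})$-sorted.
   Context: A depth-$1$ $k$-network on arrays of length $m$ is a partition of $\{1,\dots,m\}$ into comparators of size at most $k$; each comparator $S$ sorts the values at the positions of $S$ in non-decreasing order and writes them back into the positions of $S$ in increasing index order. A $0/1$-array $A$ of length $m$ is $s$-sorted if there is an integer $i$ such that $A[j]=0$ for all $1\le j<i$ and $A[j]=1$ for all $j\ge i+s$ with $j\le m$ (the set $\{i,\dots,i+s-1\}$ is called an unsorted interval). -}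

module Defs where

open import Data.Nat using (ℕ; _+_; _*_; _<_; _≤_; _<ᵇ_)
open import Data.Bool using (Bool; true; false; if_then_else_)
open import Data.Fin using (Fin; toℕ; combine) renaming (_≟_ to _≟F_)
open import Data.List using (List; length; filter; allFin)
open import Data.Product using (Σ; ∃; _×_)
open import Relation.Binary.PropositionalEquality using (_≡_)
open import Relation.Nullary using (Dec)
open import Relation.Nullary.Decidable using (_×-dec_)
open import Data.Bool.Properties using () renaming (_≟_ to _≟B_)
open import Data.Nat.Properties using (_<?_)
open import Relation.Unary using (Pred; Decidable)
import Level

-- 0/1-arrays of length m, positions 0..m-1 (paper: 1..m); false = 0, true = 1.
Array : ℕ → Set
Array m = Fin m → Bool

count : ∀ {m} {P : Pred (Fin m) Level.zero} → Decidable P → ℕ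
count {m} P? = length (filter P? (allFin m))

-- A depth-1 k-network on arrays of length m: a partition of the positions
-- into (at most r) comparators, given by a labelling  cls : Fin m → Fin r
-- (comparator S_c = { j | cls j ≡ c }), each of size at most k.
record Network (k m : ℕ) : Set where
  field
    r     : ℕ
    cls   : Fin m → Fin r
    small : ∀ (c : Fin r) → count (λ j → cls j ≟F c) ≤ k

open Network public

-- Comparator S sorts its values
-- non-decreasingly and writes them back in increasing index order: if S
-- contains z zeros, then its z smallest positions receive 0 and the rest 1.
-- So position j receives 0 iff its rank in its comparator (number of
-- positions of the same comparator with smaller index) is < z.
apply : ∀ {k m} → Network k m → Array m → Array m
apply N A j =
  if rank <ᵇ zeros then false else true
  where
    rank  = count (λ j' → (cls N j' ≟F cls N j) ×-dec (toℕ j' <? toℕ j))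
    zeros = count (λ j' → (cls N j' ≟F cls N j) ×-dec (A j' ≟B false))

-- A is s-sorted: some i with A[j] = 0 for j < i and A[j] = 1 for j ≥ i + s
-- (0-based indices; negative i of the paper is subsumed by i = 0).
SSorted : ∀ {m} → ℕ → Array m → Set
SSorted {m} s A = Σ ℕ λ i →
  (∀ (j : Fin m) → toℕ j < i → A j ≡ false) ×
  (∀ (j : Fin m) → i + s ≤ toℕ j → A j ≡ true)

block : ∀ {p n} → Array (p * n) → Fin p → Array n
block A b j = A (combine b j)

{-# OPTIONS --safe #-}
-- Write n = q t and read the array as p t rows of length q, block b being rows b t, …, b t + t − 1.
-- The network sorts every column (the positions ≡ c mod q), a comparator of p t ≤ k elements.
-- Position x is the (x / q)-th element of its column, so the output is 0 there iff x / q is below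
-- the number Z_c of zeros in its column; hence L ≤ Z_c ≤ L + W for all c makes the output
-- (W q)-sorted.  A block whose unsorted interval starts at i contributes between ⌊i/q⌋ ⊓ t and
-- ⌊i/q⌋ ⊓ t + D zeros to every column as soon as q + s ≤ D q; summing over the p blocks gives
-- W = p D, with D = 2 + ⌊s/q⌋ in general and D = 1 + s/q when q ∣ s.
module Submission where

open import Defs
open import Data.Nat using (ℕ; zero; suc; _+_; _*_; _∸_; _⊓_; _≤_; _<_; _/_; _%_; NonZero; z≤n; s≤s; z<s; _<ᵇ_; _≡ᵇ_)
open import Data.Nat.Properties
open import Data.Nat.DivMod
open import Data.Nat.Divisibility using (_∣_; divides)
open import Data.Nat.Tactic.RingSolver using (solve-∀)
open import Data.Bool using (Bool; true; false; not; _∧_; T)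
open import Data.Bool.Properties using (∧-identityʳ; ∧-zeroʳ; T-≡) renaming (_≟_ to _≟B_)
open import Data.Fin using (Fin; toℕ; fromℕ<; combine) renaming (_≟_ to _≟F_)
import Data.Fin as Fin
open import Data.Fin.Properties using (toℕ-fromℕ<; fromℕ<-toℕ; toℕ-combine; toℕ<n)
open import Data.List using (length; filter; tabulate)
open import Data.Product using (Σ; _×_; _,_; proj₁; proj₂)
open import Data.Empty using (⊥-elim)
open import Relation.Binary.PropositionalEquality
open import Relation.Nullary using (yes; no; does; _×-dec_)
open import Relation.Unary using (Pred; Decidable)
open import Algebra.Properties.Monoid.Sum +-0-monoid using (sum; sum-cong-≗; sum-syntax)
open import Algebra.Properties.CommutativeSemigroup +-commutativeSemigroup using (interchange)
open import Function.Bundles using (Equivalence)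
import Level

indicator : Bool → ℕ
indicator true  = 1
indicator false = 0

indicator≤1 : ∀ b → indicator b ≤ 1
indicator≤1 true  = ≤-refl
indicator≤1 false = z≤n

<⇒<ᵇ≡true : ∀ {m n} → m < n → (m <ᵇ n) ≡ true
<⇒<ᵇ≡true m<n = Equivalence.to T-≡ (<⇒<ᵇ m<n)

≥⇒<ᵇ≡false : ∀ {m n} → n ≤ m → (m <ᵇ n) ≡ false
≥⇒<ᵇ≡false {m} {n} n≤m with m <ᵇ n in eq
... | false = refl
... | true  = ⊥-elim (<⇒≱ (<ᵇ⇒< m n (subst T (sym eq) _)) n≤m)

<⇒≡ᵇ≡false : ∀ {m n} → m < n → (m ≡ᵇ n) ≡ false
<⇒≡ᵇ≡false {zero}  {suc n} _         = refl
<⇒≡ᵇ≡false {suc m} {suc n} (s≤s m<n) = <⇒≡ᵇ≡false m<n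

does-≟F : ∀ {m} (a b : Fin m) → does (a ≟F b) ≡ (toℕ a ≡ᵇ toℕ b)
does-≟F Fin.zero    Fin.zero    = refl
does-≟F Fin.zero    (Fin.suc b) = refl
does-≟F (Fin.suc a) Fin.zero    = refl
does-≟F (Fin.suc a) (Fin.suc b) = does-≟F a b

does-≟false : ∀ b → does (b ≟B false) ≡ not b
does-≟false true  = refl
does-≟false false = refl

count< : ℕ → (ℕ → Bool) → ℕ
count< zero    f = 0
count< (suc m) f = indicator (f 0) + count< m (λ x → f (suc x))

count<-cong : ∀ m {f g : ℕ → Bool} → (∀ x → x < m → f x ≡ g x) → count< m f ≡ count< m g
count<-cong zero    f≡g = refl
count<-cong (suc m) f≡g =
  cong₂ _+_ (cong indicator (f≡g 0 z<s)) (count<-cong m (λ x x<m → f≡g (suc x) (s≤s x<m)))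

count<≤ : ∀ m f → count< m f ≤ m
count<≤ zero    f = z≤n
count<≤ (suc m) f = +-mono-≤ (indicator≤1 (f 0)) (count<≤ m (λ x → f (suc x)))

count<-+ : ∀ a b f → count< (a + b) f ≡ count< a f + count< b (λ x → f (a + x))
count<-+ zero    b f = refl
count<-+ (suc a) b f =
  trans (cong (indicator (f 0) +_) (count<-+ a b (λ x → f (suc x)))) (sym (+-assoc (indicator (f 0)) _ _))

count<-none : ∀ m {f} → (∀ x → x < m → f x ≡ false) → count< m f ≡ 0
count<-none zero    _    = refl
count<-none (suc m) none rewrite none 0 z<s = count<-none m (λ x x<m → none (suc x) (s≤s x<m))

count<-all : ∀ m → count< m (λ _ → true) ≡ m
count<-all zero    = refl
count<-all (suc m) = cong suc (count<-all m)

count<-false-from : ∀ m j f → (∀ x → j ≤ x → f x ≡ false) → count< m f ≤ j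
count<-false-from m       zero    f none = ≤-reflexive (count<-none m (λ x _ → none x z≤n))
count<-false-from zero    (suc j) f none = z≤n
count<-false-from (suc m) (suc j) f none =
  +-mono-≤ (indicator≤1 (f 0)) (count<-false-from m j (λ x → f (suc x)) (λ x j≤x → none (suc x) (s≤s j≤x)))

count<-true-below : ∀ m j f → (∀ x → x < j → x < m → f x ≡ true) → j ⊓ m ≤ count< m f
count<-true-below zero    j       f _   = ≤-reflexive (⊓-zeroʳ j)
count<-true-below (suc m) zero    f _   = z≤n
count<-true-below (suc m) (suc j) f all rewrite all 0 z<s z<s =
  s≤s (count<-true-below m j (λ x → f (suc x)) (λ x x<j x<m → all (suc x) (s≤s x<j) (s≤s x<m)))

count<-single : ∀ m c g → c < m → count< m (λ x → (x ≡ᵇ c) ∧ g x) ≡ indicator (g c)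
count<-single (suc m) zero    g _         = trans (cong (indicator (g 0) +_) (count<-none m (λ x _ → refl))) (+-identityʳ _)
count<-single (suc m) (suc c) g (s≤s c<m) = count<-single m c (λ x → g (suc x)) c<m

count<-blocks : ∀ m t f → count< (m * t) f ≡ ∑[ b < m ] count< t (λ a → f (toℕ b * t + a))
count<-blocks zero    t f = refl
count<-blocks (suc m) t f = trans (count<-+ t (m * t) f) (cong (count< t f +_) (trans
  (count<-blocks m t (λ x → f (t + x)))
  (sum-cong-≗ {m} (λ b → count<-cong t (λ a _ → cong f (sym (+-assoc t (toℕ b * t) a)))))))

m≡[m/n]*n+m%n : ∀ m n .{{_ : NonZero n}} → m ≡ m / n * n + m % n
m≡[m/n]*n+m%n m n = trans (m≡m%n+[m/n]*n m n) (+-comm (m % n) _)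

module _ {q : ℕ} .{{_ : NonZero q}} where

  count<-residue : ∀ {c} → c < q → ∀ m g →
    count< (m * q) (λ x → (x % q ≡ᵇ c) ∧ g x) ≡ count< m (λ r → g (r * q + c))
  count<-residue {c} c<q zero    g = refl
  count<-residue {c} c<q (suc m) g =
    trans (count<-+ q (m * q) _) (cong₂ _+_ firstRow laterRows)
    where
    firstRow : count< q (λ x → (x % q ≡ᵇ c) ∧ g x) ≡ indicator (g c)
    firstRow = trans (count<-cong q (λ x x<q → cong (λ v → (v ≡ᵇ c) ∧ g x) (m<n⇒m%n≡m x<q)))
                     (count<-single q c g c<q)
    laterRows : count< (m * q) (λ x → ((q + x) % q ≡ᵇ c) ∧ g (q + x)) ≡ count< m (λ r → g (suc r * q + c))
    laterRows = trans
      (count<-cong (m * q) (λ x _ → cong (λ v → (v ≡ᵇ c) ∧ g (q + x))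
        (trans (cong (_% q) (+-comm q x)) ([m+n]%n≡m%n x q))))
      (trans (count<-residue c<q m (λ x → g (q + x)))
             (count<-cong m (λ r _ → cong g (sym (+-assoc q (r * q) c)))))

  count<-residue-all : ∀ {c} → c < q → ∀ m → count< (m * q) (λ x → x % q ≡ᵇ c) ≡ m
  count<-residue-all {c} c<q m = begin
    count< (m * q) (λ x → x % q ≡ᵇ c)               ≡⟨ count<-cong (m * q) (λ x _ → sym (∧-identityʳ _)) ⟩
    count< (m * q) (λ x → (x % q ≡ᵇ c) ∧ true)      ≡⟨ count<-residue c<q m (λ _ → true) ⟩
    count< m (λ _ → true)                           ≡⟨ count<-all m ⟩
    m                                               ∎
    where open ≡-Reasoning

  count<-residue-prefix : ∀ {c} → c < q → ∀ d → count< (d * q + c) (λ y → y % q ≡ᵇ c) ≡ d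
  count<-residue-prefix {c} c<q d = begin
    count< (d * q + c) (λ y → y % q ≡ᵇ c)                              ≡⟨ count<-+ (d * q) c _ ⟩
    count< (d * q) (λ y → y % q ≡ᵇ c) + count< c (λ y → (d * q + y) % q ≡ᵇ c)
      ≡⟨ cong₂ _+_ (count<-residue-all c<q d) (count<-none c tailRow) ⟩
    d + 0                                                              ≡⟨ +-identityʳ d ⟩
    d                                                                  ∎
    where
    open ≡-Reasoning
    tailRow : ∀ y → y < c → ((d * q + y) % q ≡ᵇ c) ≡ false
    tailRow y y<c = trans (cong (_≡ᵇ c) (trans (cong (_% q) (+-comm (d * q) y))
                            (trans ([m+kn]%n≡m%n y d q) (m<n⇒m%n≡m (<-trans y<c c<q)))))
                          (<⇒≡ᵇ≡false y<c)

  count<-residue-before : ∀ {m x} → x ≤ m → count< m (λ y → (y % q ≡ᵇ x % q) ∧ (y <ᵇ x)) ≡ x / q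
  count<-residue-before {m} {x} x≤m = begin
    count< m h                                          ≡⟨ cong (λ m′ → count< m′ h) (sym (m+[n∸m]≡n x≤m)) ⟩
    count< (x + (m ∸ x)) h                              ≡⟨ count<-+ x (m ∸ x) h ⟩
    count< x h + count< (m ∸ x) (λ y → h (x + y))       ≡⟨ cong₂ _+_ (count<-cong x before) (count<-none (m ∸ x) after) ⟩
    count< x (λ y → y % q ≡ᵇ x % q) + 0                 ≡⟨ +-identityʳ _ ⟩
    count< x (λ y → y % q ≡ᵇ x % q)                     ≡⟨ cong (λ x′ → count< x′ (λ y → y % q ≡ᵇ x % q)) (m≡[m/n]*n+m%n x q) ⟩
    count< (x / q * q + x % q) (λ y → y % q ≡ᵇ x % q)   ≡⟨ count<-residue-prefix (m%n<n x q) (x / q) ⟩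
    x / q                                               ∎
    where
    open ≡-Reasoning
    h : ℕ → Bool
    h y = (y % q ≡ᵇ x % q) ∧ (y <ᵇ x)
    before : ∀ y → y < x → h y ≡ (y % q ≡ᵇ x % q)
    before y y<x = trans (cong ((y % q ≡ᵇ x % q) ∧_) (<⇒<ᵇ≡true y<x)) (∧-identityʳ _)
    after : ∀ y → y < m ∸ x → h (x + y) ≡ false
    after y _ = trans (cong (((x + y) % q ≡ᵇ x % q) ∧_) (≥⇒<ᵇ≡false (m≤m+n x y))) (∧-zeroʳ _)

-- Positions beyond the array read as 1, which keeps columnZeros-upper free of a range hypothesis.
extend : ∀ {m} → Array m → ℕ → Bool
extend {m} A x with x <? m
... | yes x<m = A (fromℕ< x<m)
... | no  _   = true

extend-toℕ : ∀ {m} (A : Array m) (j : Fin m) → extend A (toℕ j) ≡ A j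
extend-toℕ {m} A j with toℕ j <? m
... | yes j<m = cong A (fromℕ<-toℕ j j<m)
... | no  j≮m = ⊥-elim (j≮m (toℕ<n j))

extend-false : ∀ {m} {A : Array m} {i x} → (∀ j → toℕ j < i → A j ≡ false) →
  x < i → x < m → extend A x ≡ false
extend-false {m} {A} {i} {x} zeros x<i x<m with x <? m
... | yes x<m′ = zeros (fromℕ< x<m′) (subst (_< i) (sym (toℕ-fromℕ< x<m′)) x<i)
... | no  x≮m  = ⊥-elim (x≮m x<m)

extend-true : ∀ {m} {A : Array m} {u x} → (∀ j → u ≤ toℕ j → A j ≡ true) →
  u ≤ x → extend A x ≡ true
extend-true {m} {A} {u} {x} ones u≤x with x <? m
... | yes x<m = ones (fromℕ< x<m) (subst (u ≤_) (sym (toℕ-fromℕ< x<m)) u≤x)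
... | no  _   = refl

extend-block : ∀ {p n} (A : Array (p * n)) (b : Fin p) {x} → x < n →
  extend (block A b) x ≡ extend A (n * toℕ b + x)
extend-block {n = n} A b {x} x<n = begin
  extend (block A b) x                 ≡⟨ cong (extend (block A b)) (sym (toℕ-fromℕ< x<n)) ⟩
  extend (block A b) (toℕ o)           ≡⟨ extend-toℕ (block A b) o ⟩
  A (combine b o)                      ≡⟨ extend-toℕ A (combine b o) ⟨
  extend A (toℕ (combine b o))         ≡⟨ cong (extend A) (toℕ-combine b o) ⟩
  extend A (n * toℕ b + toℕ o)         ≡⟨ cong (λ y → extend A (n * toℕ b + y)) (toℕ-fromℕ< x<n) ⟩
  extend A (n * toℕ b + x)             ∎
  where
  open ≡-Reasoning
  o = fromℕ< x<n

columnZeros : ∀ {m} → Array m → (q c rows : ℕ) → ℕ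
columnZeros A q c rows = count< rows (λ a → not (extend A (a * q + c)))

module _ {q : ℕ} .{{_ : NonZero q}} where

  *-+-<-* : ∀ {a c d} → c < q → a < d → a * q + c < d * q
  *-+-<-* {a} {c} {d} c<q a<d = begin-strict
    a * q + c   <⟨ +-monoʳ-< (a * q) c<q ⟩
    a * q + q   ≡⟨ +-comm (a * q) q ⟩
    suc a * q   ≤⟨ *-monoˡ-≤ q a<d ⟩
    d * q       ∎
    where open ≤-Reasoning

  columnZeros-lower : ∀ {m} (B : Array m) {i c t} → c < q → t * q ≤ m →
    (∀ j → toℕ j < i → B j ≡ false) → i / q ⊓ t ≤ columnZeros B q c t
  columnZeros-lower B {i} {c} {t} c<q tq≤m zeros =
    count<-true-below t (i / q) _ λ a a<i/q a<t →
      cong not (extend-false zeros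
        (<-≤-trans (*-+-<-* c<q a<i/q) (m/n*n≤m i q))
        (<-≤-trans (*-+-<-* c<q a<t) tq≤m))

  columnZeros-upper : ∀ {m} (B : Array m) {i s D c t} → q + s ≤ D * q →
    (∀ j → i + s ≤ toℕ j → B j ≡ true) → columnZeros B q c t ≤ i / q ⊓ t + D
  columnZeros-upper B {i} {s} {D} {c} {t} q+s≤Dq ones = begin
    columnZeros B q c t   ≤⟨ ⊓-glb (count<-false-from t (i / q + D) _ λ a le → cong not (extend-true ones (beyond a le)))
                                   (count<≤ t _) ⟩
    (i / q + D) ⊓ t       ≤⟨ ⊓-monoʳ-≤ (i / q + D) (m≤m+n t D) ⟩
    (i / q + D) ⊓ (t + D) ≡⟨ +-distribʳ-⊓ D (i / q) t ⟨
    i / q ⊓ t + D         ∎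
    where
    open ≤-Reasoning
    beyond : ∀ a → i / q + D ≤ a → i + s ≤ a * q + c
    beyond a le = begin
      i + s                          ≡⟨ cong (_+ s) (m≡[m/n]*n+m%n i q) ⟩
      i / q * q + i % q + s          ≤⟨ +-monoˡ-≤ s (+-monoʳ-≤ (i / q * q) (m%n≤n i q)) ⟩
      i / q * q + q + s              ≡⟨ +-assoc (i / q * q) q s ⟩
      i / q * q + (q + s)            ≤⟨ +-monoʳ-≤ (i / q * q) q+s≤Dq ⟩
      i / q * q + D * q              ≡⟨ *-distribʳ-+ q (i / q) D ⟨
      (i / q + D) * q                ≤⟨ *-monoˡ-≤ q le ⟩
      a * q                          ≤⟨ m≤m+n (a * q) c ⟩
      a * q + c                      ∎

  columnZeros-blocks : ∀ {p t} (A : Array (p * (q * t))) {c} → c < q →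
    columnZeros A q c (p * t) ≡ ∑[ b < p ] columnZeros (block A b) q c t
  columnZeros-blocks {p} {t} A {c} c<q = trans (count<-blocks p t _) (sum-cong-≗ {p} λ b →
    count<-cong t λ a a<t → cong not (sym (begin
      extend (block A b) (a * q + c)            ≡⟨ extend-block A b (subst (a * q + c <_) (*-comm t q) (*-+-<-* c<q a<t)) ⟩
      extend A (q * t * toℕ b + (a * q + c))    ≡⟨ cong (extend A) (rowMajor q t (toℕ b) a c) ⟩
      extend A ((toℕ b * t + a) * q + c)        ∎)))
    where
    open ≡-Reasoning
    rowMajor : ∀ q t b a c → q * t * b + (a * q + c) ≡ (b * t + a) * q + c
    rowMajor = solve-∀

sum-mono-≤ : ∀ {n} {f g : Fin n → ℕ} → (∀ i → f i ≤ g i) → sum f ≤ sum g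
sum-mono-≤ {zero}  f≤g = z≤n
sum-mono-≤ {suc n} f≤g = +-mono-≤ (f≤g Fin.zero) (sum-mono-≤ (λ i → f≤g (Fin.suc i)))

sum-mono-≤-+ : ∀ {n} {f g : Fin n → ℕ} D → (∀ i → f i ≤ g i + D) → sum f ≤ sum g + n * D
sum-mono-≤-+ {zero}  D f≤g+D = z≤n
sum-mono-≤-+ {suc n} {f} {g} D f≤g+D = begin
  f Fin.zero + sum (λ i → f (Fin.suc i))                ≤⟨ +-mono-≤ (f≤g+D Fin.zero) (sum-mono-≤-+ D (λ i → f≤g+D (Fin.suc i))) ⟩
  (g Fin.zero + D) + (sum (λ i → g (Fin.suc i)) + n * D) ≡⟨ interchange (g Fin.zero) D _ (n * D) ⟩
  (g Fin.zero + sum (λ i → g (Fin.suc i))) + (D + n * D) ∎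
  where open ≤-Reasoning

length-filter-tabulate : ∀ {M m} {P : Pred (Fin M) Level.zero} (P? : Decidable P) (f : Fin m → Fin M) g →
  (∀ j → does (P? (f j)) ≡ g (toℕ j)) → length (filter P? (tabulate f)) ≡ count< m g
length-filter-tabulate {m = zero}  P? f g P?≡g = refl
length-filter-tabulate {m = suc m} P? f g P?≡g rewrite P?≡g Fin.zero with g 0
... | true  = cong suc (length-filter-tabulate P? (λ j → f (Fin.suc j)) (λ x → g (suc x)) (λ j → P?≡g (Fin.suc j)))
... | false = length-filter-tabulate P? (λ j → f (Fin.suc j)) (λ x → g (suc x)) (λ j → P?≡g (Fin.suc j))

count≡count< : ∀ {m} {P : Pred (Fin m) Level.zero} (P? : Decidable P) g →
  (∀ j → does (P? j) ≡ g (toℕ j)) → count P? ≡ count< m g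
count≡count< P? = length-filter-tabulate P? (λ j → j)

rankIn : ∀ {k m} → Network k m → Fin m → ℕ
rankIn N j = count (λ j' → (cls N j' ≟F cls N j) ×-dec (toℕ j' <? toℕ j))

zerosIn : ∀ {k m} → Network k m → Array m → Fin m → ℕ
zerosIn N A j = count (λ j' → (cls N j' ≟F cls N j) ×-dec (A j' ≟B false))

apply-false : ∀ {k m} (N : Network k m) A j → rankIn N j < zerosIn N A j → apply N A j ≡ false
apply-false N A j lt rewrite <⇒<ᵇ≡true lt = refl

apply-true : ∀ {k m} (N : Network k m) A j → zerosIn N A j ≤ rankIn N j → apply N A j ≡ true
apply-true N A j ge rewrite ≥⇒<ᵇ≡false ge = refl

module _ (q : ℕ) .{{_ : NonZero q}} where

  residue : ∀ {m} → Fin m → Fin q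
  residue j = fromℕ< (m%n<n (toℕ j) q)

  does-residue-≟ : ∀ {m} (j' : Fin m) (c : Fin q) → does (residue j' ≟F c) ≡ (toℕ j' % q ≡ᵇ toℕ c)
  does-residue-≟ j' c = trans (does-≟F (residue j') c) (cong (_≡ᵇ toℕ c) (toℕ-fromℕ< (m%n<n (toℕ j') q)))

  does-residue-≟-residue : ∀ {m} (j' j : Fin m) → does (residue j' ≟F residue j) ≡ (toℕ j' % q ≡ᵇ toℕ j % q)
  does-residue-≟-residue j' j =
    trans (does-residue-≟ j' (residue j)) (cong (toℕ j' % q ≡ᵇ_) (toℕ-fromℕ< (m%n<n (toℕ j) q)))

  columnNetwork : ∀ {k m} rows → m ≡ rows * q → rows ≤ k → Network k m
  columnNetwork {k} {m} rows m≡rows*q rows≤k = record { r = q ; cls = residue ; small = classSize≤k }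
    where
    classSize≤k : ∀ c → count {m} (λ j → residue j ≟F c) ≤ k
    classSize≤k c = begin
      count {m} (λ j → residue j ≟F c)           ≡⟨ count≡count< {m} (λ j → residue j ≟F c) _ (λ j → does-residue-≟ j c) ⟩
      count< m (λ x → x % q ≡ᵇ toℕ c)            ≡⟨ cong (λ m′ → count< m′ (λ x → x % q ≡ᵇ toℕ c)) m≡rows*q ⟩
      count< (rows * q) (λ x → x % q ≡ᵇ toℕ c)   ≡⟨ count<-residue-all (toℕ<n c) rows ⟩
      rows                                       ≤⟨ rows≤k ⟩
      k                                          ∎
      where open ≤-Reasoning

  module _ {k m} rows (m≡rows*q : m ≡ rows * q) (rows≤k : rows ≤ k) where

    private
      N = columnNetwork rows m≡rows*q rows≤k

    rankIn-columnNetwork : ∀ j → rankIn N j ≡ toℕ j / q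
    rankIn-columnNetwork j = trans
      (count≡count< _ (λ y → (y % q ≡ᵇ toℕ j % q) ∧ (y <ᵇ toℕ j))
        (λ j' → cong (_∧ (toℕ j' <ᵇ toℕ j)) (does-residue-≟-residue j' j)))
      (count<-residue-before (<⇒≤ (toℕ<n j)))

    zerosIn-columnNetwork : ∀ A j → zerosIn N A j ≡ columnZeros A q (toℕ j % q) rows
    zerosIn-columnNetwork A j = begin
      zerosIn N A j                      ≡⟨ count≡count< _ column (λ j' → cong₂ _∧_ (does-residue-≟-residue j' j) (sym (zeroAt j'))) ⟩
      count< m column                    ≡⟨ cong (λ m′ → count< m′ column) m≡rows*q ⟩
      count< (rows * q) column           ≡⟨ count<-residue (m%n<n (toℕ j) q) rows (λ y → not (extend A y)) ⟩
      columnZeros A q (toℕ j % q) rows   ∎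
      where
      open ≡-Reasoning
      column : ℕ → Bool
      column y = (y % q ≡ᵇ toℕ j % q) ∧ not (extend A y)
      zeroAt : ∀ j' → not (extend A (toℕ j')) ≡ does (A j' ≟B false)
      zeroAt j' = trans (cong not (extend-toℕ A j')) (sym (does-≟false (A j')))

    columnNetwork-sorted : ∀ A {L W} →
      (∀ c → c < q → L ≤ columnZeros A q c rows) → (∀ c → c < q → columnZeros A q c rows ≤ L + W) →
      SSorted (W * q) (apply N A)
    columnNetwork-sorted A {L} {W} lower upper = L * q , zerosBefore , onesAfter
      where
      zerosBefore : ∀ j → toℕ j < L * q → apply N A j ≡ false
      zerosBefore j j<Lq = apply-false N A j (begin-strict
        rankIn N j                           ≡⟨ rankIn-columnNetwork j ⟩
        toℕ j / q                            <⟨ m<n*o⇒m/o<n j<Lq ⟩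
        L                                    ≤⟨ lower (toℕ j % q) (m%n<n (toℕ j) q) ⟩
        columnZeros A q (toℕ j % q) rows     ≡⟨ zerosIn-columnNetwork A j ⟨
        zerosIn N A j                        ∎)
        where open ≤-Reasoning
      onesAfter : ∀ j → L * q + W * q ≤ toℕ j → apply N A j ≡ true
      onesAfter j Lq+Wq≤j = apply-true N A j (begin
        zerosIn N A j                        ≡⟨ zerosIn-columnNetwork A j ⟩
        columnZeros A q (toℕ j % q) rows     ≤⟨ upper (toℕ j % q) (m%n<n (toℕ j) q) ⟩
        L + W                                ≡⟨ m*n/n≡m (L + W) q ⟨
        (L + W) * q / q                      ≤⟨ /-monoˡ-≤ q (subst (_≤ toℕ j) (sym (*-distribʳ-+ q L W)) Lq+Wq≤j) ⟩
        toℕ j / q                            ≡⟨ rankIn-columnNetwork j ⟨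
        rankIn N j                           ∎)
        where open ≤-Reasoning

layout : ∀ p q t → p * (q * t) ≡ p * t * q
layout = solve-∀

module _ {k} (p q t : ℕ) .{{_ : NonZero q}} (pt≤k : p * t ≤ k) where

  stridedNetwork : Network k (p * (q * t))
  stridedNetwork = columnNetwork q (p * t) (layout p q t) pt≤k

  stridedNetwork-sorted : ∀ {s D} → q + s ≤ D * q → (A : Array (p * (q * t))) →
    (∀ b → SSorted s (block A b)) → SSorted (p * D * q) (apply stridedNetwork A)
  stridedNetwork-sorted {s} {D} q+s≤Dq A sorted =
    columnNetwork-sorted q (p * t) (layout p q t) pt≤k A {L} lower upper
    where
    start : Fin p → ℕ
    start b = proj₁ (sorted b)
    L : ℕ
    L = ∑[ b < p ] (start b / q ⊓ t)
    lower : ∀ c → c < q → L ≤ columnZeros A q c (p * t)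
    lower c c<q = subst (L ≤_) (sym (columnZeros-blocks {p = p} {t = t} A c<q)) (sum-mono-≤ λ b →
      columnZeros-lower (block A b) c<q (≤-reflexive (*-comm t q)) (proj₁ (proj₂ (sorted b))))
    upper : ∀ c → c < q → columnZeros A q c (p * t) ≤ L + p * D
    upper c c<q = subst (_≤ L + p * D) (sym (columnZeros-blocks {p = p} {t = t} A c<q)) (sum-mono-≤-+ D λ b →
      columnZeros-upper (block A b) q+s≤Dq (proj₂ (proj₂ (sorted b))))

SSorted-mono : ∀ {m s s′} {A : Array m} → s ≤ s′ → SSorted s A → SSorted s′ A
SSorted-mono s≤s′ (i , zeros , ones) = i , zeros , λ j i+s′≤j → ones j (≤-trans (+-monoʳ-≤ i s≤s′) i+s′≤j)

m*n*o/n≡m*o : ∀ m n o .{{_ : NonZero n}} → m * n * o / n ≡ m * o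
m*n*o/n≡m*o m n o = trans (cong (_/ n) (reorder m n o)) (m*n/n≡m (m * o) n)
  where
  reorder : ∀ m n o → m * n * o ≡ m * o * n
  reorder = solve-∀

n+m≤[2+m/n]*n : ∀ m n .{{_ : NonZero n}} → n + m ≤ (2 + m / n) * n
n+m≤[2+m/n]*n m n = +-monoʳ-≤ n (begin
  m                   ≡⟨ m≡m%n+[m/n]*n m n ⟩
  m % n + m / n * n   ≤⟨ +-monoˡ-≤ (m / n * n) (m%n≤n m n) ⟩
  n + m / n * n       ∎)
  where open ≤-Reasoning

p*[2+s/q]*q≤s*p+2*[q*p] : ∀ p q s .{{_ : NonZero q}} → p * (2 + s / q) * q ≤ s * p + 2 * (q * p)
p*[2+s/q]*q≤s*p+2*[q*p] p q s = begin
  p * (2 + s / q) * q           ≡⟨ expand p (s / q) q ⟩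
  p * (s / q * q) + 2 * (q * p) ≤⟨ +-monoˡ-≤ (2 * (q * p)) (*-monoʳ-≤ p (m/n*n≤m s q)) ⟩
  p * s + 2 * (q * p)           ≡⟨ cong (_+ 2 * (q * p)) (*-comm p s) ⟩
  s * p + 2 * (q * p)           ∎
  where
  open ≤-Reasoning
  expand : ∀ p x q → p * (2 + x) * q ≡ p * (x * q) + 2 * (q * p)
  expand = solve-∀

p*[1+d]*q≡d*q*p+q*p : ∀ p d q → p * (1 + d) * q ≡ d * q * p + q * p
p*[1+d]*q≡d*q*p+q*p = solve-∀

mainTheorem10 : (k t p n s : ℕ) → .{{_ : NonZero t}} →
    1 ≤ k → 1 ≤ p → 1 ≤ n → 1 ≤ s →
    t * p ≤ k → t ∣ n →
    Σ (Network k (p * n)) λ N →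
      (∀ (A : Array (p * n)) → (∀ (b : Fin p) → SSorted s (block A b)) →
        SSorted (s * p + 2 * ((n * p) / t)) (apply N A))
      ×
      ((n / t) ∣ s → ∀ (A : Array (p * n)) → (∀ (b : Fin p) → SSorted s (block A b)) →
        SSorted (s * p + (n * p) / t) (apply N A))
mainTheorem10 k t p .(0 * t)       s _ _ () _ _    (divides zero refl)
mainTheorem10 k t p .(suc q′ * t) s _ _ _  _ tp≤k (divides (suc q′) refl) = network , general , divisible
  where
  q = suc q′
  pt≤k : p * t ≤ k
  pt≤k = subst (_≤ k) (*-comm t p) tp≤k
  network : Network k (p * (q * t))
  network = stridedNetwork p q t pt≤k
  np/t≡qp : q * t * p / t ≡ q * p
  np/t≡qp = m*n*o/n≡m*o q t p
  general : ∀ A → (∀ b → SSorted s (block A b)) → SSorted (s * p + 2 * (q * t * p / t)) (apply network A)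
  general A sorted = SSorted-mono width (stridedNetwork-sorted p q t pt≤k (n+m≤[2+m/n]*n s q) A sorted)
    where
    width : p * (2 + s / q) * q ≤ s * p + 2 * (q * t * p / t)
    width = subst (λ w → p * (2 + s / q) * q ≤ s * p + 2 * w) (sym np/t≡qp) (p*[2+s/q]*q≤s*p+2*[q*p] p q s)
  divisible : q * t / t ∣ s → ∀ A → (∀ b → SSorted s (block A b)) →
    SSorted (s * p + q * t * p / t) (apply network A)
  divisible (divides d s≡d*[n/t]) A sorted =
    SSorted-mono (≤-reflexive width) (stridedNetwork-sorted p q t pt≤k (≤-reflexive (cong (q +_) s≡d*q)) A sorted)
    where
    s≡d*q : s ≡ d * q
    s≡d*q = trans s≡d*[n/t] (cong (d *_) (m*n/n≡m q t))
    width : p * (1 + d) * q ≡ s * p + q * t * p / t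
    width = trans (p*[1+d]*q≡d*q*p+q*p p d q) (cong₂ _+_ (cong (_* p) (sym s≡d*q)) (sym np/t≡qp))
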